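{- For each positive integer $n$, the following hold. (i) $[F_n,F_{n+1}]=F_nF_{n+1}$. (ii) $[F_n,F_{n+1},F_{n+2}]=F_nF_{n+1}F_{n+2}$. (iii) $[F_n,F_{n+1},F_{n+2},F_{n+3}]=\frac{F_nF_{n+1}F_{n+2}F_{n+3}}{F_{(n,3)}}$. (iv) $[F_n,\ldots,F_{n+4}]=\frac{F_nF_{n+1}F_{n+2}F_{n+3}F_{n+4}}{F_{(n,4)}}$ if $n\equiv 1\pmod 3$, and $=\frac{F_nF_{n+1}F_{n+2}F_{n+3}F_{n+4}}{2F_{(n,4)}}$ if $n\equiv 0,2\pmod 3$. (v) $[F_n,\ldots,F_{n+5}]=\frac{F_nF_{n+1}\cdots F_{n+5}}{2F_{(n,5)}}$ if $n\equiv 1,2\pmod 4$, and $=\frac{F_nF_{n+1}\cdots F_{n+5}}{6F_{(n,5)}}$ if $n\equiv 0,3\pmod 4$. (vi) $[F_n,\ldots,F_{n+6}]=\frac{F_nF_{n+1}\cdots F_{n+6}}{2F_{(n(n+1),5)}F_{(n,6)}}$ if $n\equiv 1\pmod 4$, and $=\frac{F_nF_{n+1}\cdots F_{n+6}}{6F_{(n(n+1),5)}F_{(n,6)}}$ if $n\equiv 0,2,3\pmod 4$.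
   Context: $F_n$ is the $n$th Fibonacci number: $F_1=F_2=1$, $F_n=F_{n-1}+F_{n-2}$ for $n\ge 3$. $(a_1,\ldots,a_k)$ denotes the gcd and $[a_1,\ldots,a_k]$ the lcm; thus e.g. $F_{(n,3)}$ is the Fibonacci number with index $\gcd(n,3)$ and $F_{(n(n+1),5)}$ the one with index $\gcd(n(n+1),5)$. -}

module Defs where

open import Data.Nat using (ℕ; zero; suc; _+_; _*_)
open import Data.Nat.LCM using (lcm)

F : ℕ → ℕ
F zero = 0
F (suc zero) = 1
F (suc (suc n)) = F (suc n) + F n

lcmF : ℕ → ℕ → ℕ
lcmF n zero = F n
lcmF n (suc k) = lcm (lcmF n k) (F (n + suc k))

prodF : ℕ → ℕ → ℕ
prodF n zero = F n
prodF n (suc k) = prodF n k * F (n + suc k)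

{-# OPTIONS --safe #-}
module Submission where

-- Since lcm L c · gcd L c = L c, the quotient prodF n k / lcmF n k is the product over j < k of
-- gcd (lcmF n j) (F (n + j + 1)). Distributing gcd over lcm and using strong divisibility
-- gcd (F a) (F b) = F (gcd a b), each factor is the lcm of the numbers F (gcd (n + i) (j + 1 − i)),
-- i ≤ j. For k ≤ 6 these depend only on n mod 60 = lcm (1, …, 6), and so do the denominators
-- claimed in the theorem; the 60 residues are then checked by evaluation.

open import Defs
open import Data.Nat
open import Data.Nat.Coprimality as Coprimality using (Coprime; coprime-+; coprime-divisor)
open import Data.Nat.Divisibility
open import Data.Nat.DivMod
open import Data.Nat.GCD
open import Data.Nat.Induction using (<′-Rec; <′-recBuilder)
open import Data.Nat.LCM
open import Data.Nat.Properties
open import Algebra.Properties.CommutativeSemigroup *-commutativeSemigroup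
  using (x∙yz≈y∙zx; x∙yz≈yx∙z)
open import Data.Nat.Tactic.RingSolver using (solve-∀)
open import Data.Product using (_×_; _,_; proj₁; proj₂; uncurry)
open import Data.Sum using (_⊎_; inj₁)
open import Function using (id; _∘_)
open import Induction using (build)
open import Induction.Lexicographic using (_⊗_; [_⊗_])
open import Relation.Binary.PropositionalEquality
  using (_≡_; refl; sym; trans; cong; cong₂; subst; subst₂; module ≡-Reasoning)
open import Relation.Nullary using (Dec; _×-dec_; _⊎-dec_; _→-dec_)
open import Relation.Nullary.Decidable using (toWitness)

euclid-induction : ∀ {ℓ} (P : ℕ → ℕ → Set ℓ) →
  (∀ n → P 0 n) → (∀ {m n} → P m n → P n m) → (∀ {m n} → P m n → P m (m + n)) →
  ∀ m n → P m n
euclid-induction P base swap step m n =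
  build [ <′-recBuilder ⊗ <′-recBuilder ] (uncurry P) go (m , n)
  where
  go : ∀ p → (<′-Rec ⊗ <′-Rec) (uncurry P) p → uncurry P p
  go (zero , n) _ = base n
  go (suc m , zero) _ = swap (base (suc m))
  go (suc m , suc n) rec with compare m n
  ... | less m k = subst (P (suc m)) (cong suc (+-suc m k))
        (step (proj₁ rec (≤⇒≤′ (s≤s (s≤s (m≤n+m k m))))))
  ... | equal m = subst (P (suc m)) (+-identityʳ (suc m)) (step (swap (base (suc m))))
  ... | greater n k = swap (subst (P (suc n)) (cong suc (+-suc n k))
        (step (proj₂ rec (≤⇒≤′ (s≤s (s≤s (m≤m+n n k)))) (suc k))))

gcd[m,m+n]≡gcd[m,n] : ∀ m n → gcd m (m + n) ≡ gcd m n
gcd[m,m+n]≡gcd[m,n] m n = GCD.unique (gcd-GCD m (m + n)) (GCD.step (gcd-GCD m n))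

gcd[m,m*k+n]≡gcd[m,n] : ∀ m k n → gcd m (m * k + n) ≡ gcd m n
gcd[m,m*k+n]≡gcd[m,n] m k n = ∣-antisym
  (gcd-greatest (gcd[m,n]∣m m _) (∣m+n∣m⇒∣n (gcd[m,n]∣n m _) (∣m⇒∣m*n k (gcd[m,n]∣m m _))))
  (gcd-greatest (gcd[m,n]∣m m n) (∣m∣n⇒∣m+n (∣m⇒∣m*n k (gcd[m,n]∣m m n)) (gcd[m,n]∣n m n)))

coprime⇒gcd[m,k*n]≡gcd[m,n] : ∀ {m k} n → Coprime m k → gcd m (k * n) ≡ gcd m n
coprime⇒gcd[m,k*n]≡gcd[m,n] {m} {k} n m⊥k = ∣-antisym
  (gcd-greatest (gcd[m,n]∣m m _) (coprime-divisor g⊥k (gcd[m,n]∣n m (k * n))))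
  (gcd-greatest (gcd[m,n]∣m m n) (∣n⇒∣m*n k (gcd[m,n]∣n m n)))
  where
  g⊥k : Coprime (gcd m (k * n)) k
  g⊥k (i∣g , i∣k) = m⊥k (∣-trans i∣g (gcd[m,n]∣m m _) , i∣k)

gcd[n+i,n+m]≡gcd[n+i,m∸i] : ∀ n {i m} → i ≤ m → gcd (n + i) (n + m) ≡ gcd (n + i) (m ∸ i)
gcd[n+i,n+m]≡gcd[n+i,m∸i] n {i} {m} i≤m = begin
  gcd (n + i) (n + m)             ≡⟨ cong (λ x → gcd (n + i) (n + x)) (sym (m+[n∸m]≡n i≤m)) ⟩
  gcd (n + i) (n + (i + (m ∸ i))) ≡⟨ cong (gcd (n + i)) (sym (+-assoc n i (m ∸ i))) ⟩
  gcd (n + i) (n + i + (m ∸ i))   ≡⟨ gcd[m,m+n]≡gcd[m,n] (n + i) (m ∸ i) ⟩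
  gcd (n + i) (m ∸ i)             ∎
  where open ≡-Reasoning

F-+ : ∀ m n → F (suc m + n) ≡ F (suc m) * F (suc n) + F m * F n
F-+ zero n = sym (trans (+-identityʳ _) (*-identityˡ (F (suc n))))
F-+ (suc m) n = begin
  F (suc (suc m) + n)                            ≡⟨ cong F (sym (+-suc (suc m) n)) ⟩
  F (suc m + suc n)                              ≡⟨ F-+ m (suc n) ⟩
  F (suc m) * F (suc (suc n)) + F m * F (suc n)  ≡⟨ regroup (F (suc m)) (F m) (F (suc n)) (F n) ⟩
  F (suc (suc m)) * F (suc n) + F (suc m) * F n  ∎
  where
  open ≡-Reasoning
  regroup : ∀ a b x y → a * (x + y) + b * x ≡ (a + b) * x + a * y
  regroup = solve-∀

F-coprime : ∀ n → Coprime (F n) (F (suc n))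
F-coprime zero = ∣1⇒≡1 ∘ proj₂
F-coprime (suc n) = Coprimality.sym (coprime-+ (F-coprime n))

gcd[Fm,F[m+n]]≡gcd[Fm,Fn] : ∀ m n → gcd (F m) (F (m + n)) ≡ gcd (F m) (F n)
gcd[Fm,F[m+n]]≡gcd[Fm,Fn] zero n = refl
gcd[Fm,F[m+n]]≡gcd[Fm,Fn] (suc m) n = begin
  gcd (F (suc m)) (F (suc m + n))                      ≡⟨ cong (gcd (F (suc m))) (F-+ m n) ⟩
  gcd (F (suc m)) (F (suc m) * F (suc n) + F m * F n)
    ≡⟨ gcd[m,m*k+n]≡gcd[m,n] (F (suc m)) (F (suc n)) _ ⟩
  gcd (F (suc m)) (F m * F n)
    ≡⟨ coprime⇒gcd[m,k*n]≡gcd[m,n] (F n) (Coprimality.sym (F-coprime m)) ⟩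
  gcd (F (suc m)) (F n)                                ∎
  where open ≡-Reasoning

gcd[Fm,Fn]≡F[gcd[m,n]] : ∀ m n → gcd (F m) (F n) ≡ F (gcd m n)
gcd[Fm,Fn]≡F[gcd[m,n]] = euclid-induction (λ m n → gcd (F m) (F n) ≡ F (gcd m n))
  (λ n → trans (gcd-identityˡ (F n)) (cong F (sym (gcd-identityˡ n))))
  (λ {m} {n} eq → trans (gcd-comm (F n) (F m)) (trans eq (cong F (gcd-comm m n))))
  (λ {m} {n} eq → trans (gcd[Fm,F[m+n]]≡gcd[Fm,Fn] m n)
                     (trans eq (cong F (sym (gcd[m,m+n]≡gcd[m,n] m n)))))

gcd-monoˡ-∣ : ∀ {a b} c → a ∣ b → gcd a c ∣ gcd b c
gcd-monoˡ-∣ {a} c a∣b = gcd-greatest (∣-trans (gcd[m,n]∣m a c) a∣b) (gcd[m,n]∣n a c)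

lcm-mono-∣ : ∀ {a b c d} → a ∣ c → b ∣ d → lcm a b ∣ lcm c d
lcm-mono-∣ {c = c} {d} a∣c b∣d =
  lcm-least (∣-trans a∣c (m∣lcm[m,n] c d)) (∣-trans b∣d (n∣lcm[m,n] c d))

-- With w = gcd p q it suffices that w g ∣ p q = w · lcm p q. Expanding p q = gcd (p g) (p b)
-- and p b = gcd (b g) (b a), only w g ∣ a b is left, and it holds as g ∣ lcm a b, w ∣ gcd a b.
∣lcm⇒∣lcm[gcd,gcd] : ∀ g {a b} → g ∣ lcm a b → g ∣ lcm (gcd g a) (gcd g b)
∣lcm⇒∣lcm[gcd,gcd] zero {a} {b} 0∣lcm =
  subst₂ (λ x y → 0 ∣ lcm x y) (sym (gcd-identityˡ a)) (sym (gcd-identityˡ b)) 0∣lcm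
∣lcm⇒∣lcm[gcd,gcd] g@(suc _) {a} {b} g∣lcm =
  *-cancelˡ-∣ w (subst (w * g ∣_) (sym (gcd*lcm p q)) w*g∣p*q)
  where
  p = gcd g a
  q = gcd g b
  w = gcd p q
  instance
    w≢0 : NonZero w
    w≢0 = ≢-nonZero (gcd[m,n]≢0 p q (inj₁ (gcd[m,n]≢0 g a (inj₁ λ ()))))
  w∣a : w ∣ a
  w∣a = ∣-trans (gcd[m,n]∣m p q) (gcd[m,n]∣n g a)
  w∣b : w ∣ b
  w∣b = ∣-trans (gcd[m,n]∣n p q) (gcd[m,n]∣n g b)
  w*g∣b*a : w * g ∣ b * a
  w*g∣b*a = subst (w * g ∣_) (trans (gcd*lcm a b) (*-comm a b))
    (*-pres-∣ (gcd-greatest w∣a w∣b) g∣lcm)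
  w*g∣p*b : w * g ∣ p * b
  w*g∣p*b = subst (w * g ∣_) (trans (sym (c*gcd[m,n]≡gcd[cm,cn] b g a)) (*-comm b p))
    (gcd-greatest (*-monoˡ-∣ g w∣b) w*g∣b*a)
  w*g∣p*q : w * g ∣ p * q
  w*g∣p*q = subst (w * g ∣_) (sym (c*gcd[m,n]≡gcd[cm,cn] p g b))
    (gcd-greatest (*-monoˡ-∣ g (gcd[m,n]∣m p q)) w*g∣p*b)

gcd-distribʳ-lcm : ∀ c a b → gcd (lcm a b) c ≡ lcm (gcd a c) (gcd b c)
gcd-distribʳ-lcm c a b = ∣-antisym
  (∣-trans (∣lcm⇒∣lcm[gcd,gcd] g (gcd[m,n]∣m (lcm a b) c))
           (lcm-mono-∣ (gcd[g,x]∣gcd[x,c] a) (gcd[g,x]∣gcd[x,c] b)))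
  (lcm-least (gcd-monoˡ-∣ c (m∣lcm[m,n] a b)) (gcd-monoˡ-∣ c (n∣lcm[m,n] a b)))
  where
  g = gcd (lcm a b) c
  gcd[g,x]∣gcd[x,c] : ∀ x → gcd g x ∣ gcd x c
  gcd[g,x]∣gcd[x,c] x =
    gcd-greatest (gcd[m,n]∣n g x) (∣-trans (gcd[m,n]∣m g x) (gcd[m,n]∣n (lcm a b) c))

gcdLcmF : ℕ → ℕ → ℕ → ℕ
gcdLcmF n zero    m = F (gcd n m)
gcdLcmF n (suc k) m = lcm (gcdLcmF n k m) (F (gcd (n + suc k) (m ∸ suc k)))

gcd[lcmF,F]≡gcdLcmF : ∀ n {k m} → k < m → gcd (lcmF n k) (F (n + m)) ≡ gcdLcmF n k m
gcd[lcmF,F]≡gcdLcmF n {zero} {m} _ = begin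
  gcd (F n) (F (n + m))  ≡⟨ gcd[Fm,Fn]≡F[gcd[m,n]] n (n + m) ⟩
  F (gcd n (n + m))      ≡⟨ cong F (gcd[m,m+n]≡gcd[m,n] n m) ⟩
  F (gcd n m)            ∎
  where open ≡-Reasoning
gcd[lcmF,F]≡gcdLcmF n {suc k} {m} k<m = begin
  gcd (lcm (lcmF n k) (F (n + suc k))) (F (n + m))
    ≡⟨ gcd-distribʳ-lcm (F (n + m)) (lcmF n k) (F (n + suc k)) ⟩
  lcm (gcd (lcmF n k) (F (n + m))) (gcd (F (n + suc k)) (F (n + m)))
    ≡⟨ cong₂ lcm (gcd[lcmF,F]≡gcdLcmF n (<⇒≤ k<m))
                 (gcd[Fm,Fn]≡F[gcd[m,n]] (n + suc k) (n + m)) ⟩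
  lcm (gcdLcmF n k m) (F (gcd (n + suc k) (n + m)))
    ≡⟨ cong (lcm (gcdLcmF n k m) ∘ F) (gcd[n+i,n+m]≡gcd[n+i,m∸i] n (<⇒≤ k<m)) ⟩
  lcm (gcdLcmF n k m) (F (gcd (n + suc k) (m ∸ suc k)))
    ∎
  where open ≡-Reasoning

defect : ℕ → ℕ → ℕ
defect n zero    = 1
defect n (suc k) = defect n k * gcdLcmF n k (suc k)

lcm*[d*gcd]≡P*c : ∀ L c d P → L * d ≡ P → lcm L c * (d * gcd L c) ≡ P * c
lcm*[d*gcd]≡P*c L c d P L*d≡P = begin
  lcm L c * (d * gcd L c)  ≡⟨ x∙yz≈y∙zx (lcm L c) d (gcd L c) ⟩
  d * (gcd L c * lcm L c)  ≡⟨ cong (d *_) (gcd*lcm L c) ⟩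
  d * (L * c)              ≡⟨ x∙yz≈yx∙z d L c ⟩
  L * d * c                ≡⟨ cong (_* c) L*d≡P ⟩
  P * c                    ∎
  where open ≡-Reasoning

lcmF*defect≡prodF : ∀ n k → lcmF n k * defect n k ≡ prodF n k
lcmF*defect≡prodF n zero = *-identityʳ (F n)
lcmF*defect≡prodF n (suc k) =
  subst (λ g → lcmF n (suc k) * (defect n k * g) ≡ prodF n (suc k))
    (gcd[lcmF,F]≡gcdLcmF n (n<1+n k))
    (lcm*[d*gcd]≡P*c (lcmF n k) (F (n + suc k)) (defect n k) (prodF n k) (lcmF*defect≡prodF n k))

%-cong-∣ : ∀ {p d a b} .{{_ : NonZero p}} .{{_ : NonZero d}} →
  d ∣ p → a % p ≡ b % p → a % d ≡ b % d
%-cong-∣ {p} {d} {a} {b} d∣p a≡b = begin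
  a % d      ≡⟨ m∣n⇒o%n%m≡o%m d p a d∣p ⟨
  a % p % d  ≡⟨ cong (_% d) a≡b ⟩
  b % p % d  ≡⟨ m∣n⇒o%n%m≡o%m d p b d∣p ⟩
  b % d      ∎
  where open ≡-Reasoning

%-cong-+ʳ : ∀ {p a b} .{{_ : NonZero p}} c → a % p ≡ b % p → (a + c) % p ≡ (b + c) % p
%-cong-+ʳ {p} {a} {b} c a≡b = begin
  (a + c) % p            ≡⟨ %-distribˡ-+ a c p ⟩
  (a % p + c % p) % p    ≡⟨ cong (λ x → (x + c % p) % p) a≡b ⟩
  (b % p + c % p) % p    ≡⟨ %-distribˡ-+ b c p ⟨
  (b + c) % p            ∎
  where open ≡-Reasoning

%-cong-* : ∀ {p a b c d} .{{_ : NonZero p}} →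
  a % p ≡ b % p → c % p ≡ d % p → (a * c) % p ≡ (b * d) % p
%-cong-* {p} {a} {b} {c} {d} a≡b c≡d = begin
  (a * c) % p            ≡⟨ %-distribˡ-* a c p ⟩
  (a % p * (c % p)) % p  ≡⟨ cong₂ (λ x y → (x * y) % p) a≡b c≡d ⟩
  (b % p * (d % p)) % p  ≡⟨ %-distribˡ-* b d p ⟨
  (b * d) % p            ∎
  where open ≡-Reasoning

gcd-cong-% : ∀ {d a b} .{{_ : NonZero d}} → a % d ≡ b % d → gcd a d ≡ gcd b d
gcd-cong-% {d} a≡b = ∣-antisym (to a≡b) (to (sym a≡b))
  where
  to : ∀ {x y} → x % d ≡ y % d → gcd x d ∣ gcd y d
  to {x} x≡y = gcd-greatest
    (∣n∣m%n⇒∣m (gcd[m,n]∣n x d)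
      (subst (gcd x d ∣_) x≡y (%-presˡ-∣ (gcd[m,n]∣m x d) (gcd[m,n]∣n x d))))
    (gcd[m,n]∣n x d)

j∣60 : ∀ {j} → 0 < j → j ≤ 6 → j ∣ 60
j∣60 {1} _ _ = divides 60 refl
j∣60 {2} _ _ = divides 30 refl
j∣60 {3} _ _ = divides 20 refl
j∣60 {4} _ _ = divides 15 refl
j∣60 {5} _ _ = divides 12 refl
j∣60 {6} _ _ = divides 10 refl
j∣60 {suc (suc (suc (suc (suc (suc (suc _))))))} _ (s≤s (s≤s (s≤s (s≤s (s≤s (s≤s ()))))))

gcd-cong-%60 : ∀ {a b} j → 0 < j → j ≤ 6 → a % 60 ≡ b % 60 → gcd a j ≡ gcd b j
gcd-cong-%60 {a} {b} (suc j) 0<j j≤6 a≡b =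
  gcd-cong-% {a = a} {b} (%-cong-∣ {a = a} {b} (j∣60 0<j j≤6) a≡b)

gcdLcmF-%60 : ∀ n {k m} → k < m → m ≤ 6 → gcdLcmF n k m ≡ gcdLcmF (n % 60) k m
gcdLcmF-%60 n {zero} {m} 0<m m≤6 =
  cong F (gcd-cong-%60 {n} {n % 60} m 0<m m≤6 (sym (m%n%n≡m%n n 60)))
gcdLcmF-%60 n {suc k} {m} k<m m≤6 = cong₂ lcm (gcdLcmF-%60 n (<⇒≤ k<m) m≤6)
  (cong F (gcd-cong-%60 {n + suc k} {n % 60 + suc k} (m ∸ suc k)
    (m<n⇒0<n∸m k<m) (≤-trans (m∸n≤m m (suc k)) m≤6)
    (%-cong-+ʳ {a = n} {b = n % 60} (suc k) (sym (m%n%n≡m%n n 60)))))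

defect-%60 : ∀ n {k} → k ≤ 6 → defect n k ≡ defect (n % 60) k
defect-%60 n {zero} _ = refl
defect-%60 n {suc k} k+1≤6 = cong₂ _*_ (defect-%60 n (<⇒≤ k+1≤6)) (gcdLcmF-%60 n (n<1+n k) k+1≤6)

Denominators : ℕ → (ℕ → ℕ) → Set
Denominators n d =
    (d 1 ≡ 1)
  × (d 2 ≡ 1)
  × (d 3 ≡ F (gcd n 3))
  × ((n % 3 ≡ 1 → d 4 ≡ F (gcd n 4))
     × (n % 3 ≡ 0 ⊎ n % 3 ≡ 2 → d 4 ≡ 2 * F (gcd n 4)))
  × ((n % 4 ≡ 1 ⊎ n % 4 ≡ 2 → d 5 ≡ 2 * F (gcd n 5))
     × (n % 4 ≡ 0 ⊎ n % 4 ≡ 3 → d 5 ≡ 6 * F (gcd n 5)))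
  × ((n % 4 ≡ 1 → d 6 ≡ 2 * F (gcd (n * (n + 1)) 5) * F (gcd n 6))
     × (n % 4 ≡ 0 ⊎ n % 4 ≡ 2 ⊎ n % 4 ≡ 3 → d 6 ≡ 6 * F (gcd (n * (n + 1)) 5) * F (gcd n 6)))

denominators? : ∀ n d → Dec (Denominators n d)
denominators? n d =
      d 1 ≟ 1
  ×-dec d 2 ≟ 1
  ×-dec d 3 ≟ F (gcd n 3)
  ×-dec ((n % 3 ≟ 1 →-dec d 4 ≟ F (gcd n 4))
         ×-dec ((n % 3 ≟ 0 ⊎-dec n % 3 ≟ 2) →-dec d 4 ≟ 2 * F (gcd n 4)))
  ×-dec (((n % 4 ≟ 1 ⊎-dec n % 4 ≟ 2) →-dec d 5 ≟ 2 * F (gcd n 5))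
         ×-dec ((n % 4 ≟ 0 ⊎-dec n % 4 ≟ 3) →-dec d 5 ≟ 6 * F (gcd n 5)))
  ×-dec ((n % 4 ≟ 1 →-dec d 6 ≟ 2 * F (gcd (n * (n + 1)) 5) * F (gcd n 6))
         ×-dec ((n % 4 ≟ 0 ⊎-dec n % 4 ≟ 2 ⊎-dec n % 4 ≟ 3)
                  →-dec d 6 ≟ 6 * F (gcd (n * (n + 1)) 5) * F (gcd n 6)))

denominators-<60 : ∀ {r} → r < 60 → Denominators r (defect r)
denominators-<60 = toWitness {a? = allUpTo? (λ r → denominators? r (defect r)) 60} _

Denominators-cong : ∀ n {d d′} → (∀ {k} → k ≤ 6 → d k ≡ d′ k) →
                    Denominators n d′ → Denominators n d
Denominators-cong n d≗d′
  rewrite d≗d′ (m≤m+n 1 5) | d≗d′ (m≤m+n 2 4) | d≗d′ (m≤m+n 3 3)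
        | d≗d′ (m≤m+n 4 2) | d≗d′ (m≤m+n 5 1) | d≗d′ (m≤m+n 6 0) = id

Denominators-cong-%60 : ∀ {m n} d → m % 60 ≡ n % 60 → Denominators n d → Denominators m d
Denominators-cong-%60 {m} {n} d m≡n
  rewrite %-cong-∣ {d = 3} {m} {n} (divides 20 refl) m≡n
        | %-cong-∣ {d = 4} {m} {n} (divides 15 refl) m≡n
        | gcd-cong-%60 {m} {n} 3 (s≤s z≤n) (m≤m+n 3 3) m≡n
        | gcd-cong-%60 {m} {n} 4 (s≤s z≤n) (m≤m+n 4 2) m≡n
        | gcd-cong-%60 {m} {n} 5 (s≤s z≤n) (m≤m+n 5 1) m≡n
        | gcd-cong-%60 {m} {n} 6 (s≤s z≤n) (m≤m+n 6 0) m≡n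
        | gcd-cong-%60 {m * (m + 1)} {n * (n + 1)} 5 (s≤s z≤n) (m≤m+n 5 1)
            (%-cong-* {a = m} {n} m≡n (%-cong-+ʳ {a = m} {n} 1 m≡n)) = id

denominators : ∀ n → Denominators n (defect n)
denominators n = Denominators-cong-%60 {n} {n % 60} (defect n) (sym (m%n%n≡m%n n 60))
  (Denominators-cong (n % 60) (defect-%60 n) (denominators-<60 (m%n<n n 60)))

lcmF*d≡prodF : ∀ n k {d} → defect n k ≡ d → lcmF n k * d ≡ prodF n k
lcmF*d≡prodF n k refl = lcmF*defect≡prodF n k

lemma2p4 : (n : ℕ) → n ≥ 1 →
      (lcmF n 1 ≡ prodF n 1)
    × (lcmF n 2 ≡ prodF n 2)
    × (lcmF n 3 * F (gcd n 3) ≡ prodF n 3)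
    × ((n % 3 ≡ 1 → lcmF n 4 * F (gcd n 4) ≡ prodF n 4)
       × (n % 3 ≡ 0 ⊎ n % 3 ≡ 2 → lcmF n 4 * (2 * F (gcd n 4)) ≡ prodF n 4))
    × ((n % 4 ≡ 1 ⊎ n % 4 ≡ 2 → lcmF n 5 * (2 * F (gcd n 5)) ≡ prodF n 5)
       × (n % 4 ≡ 0 ⊎ n % 4 ≡ 3 → lcmF n 5 * (6 * F (gcd n 5)) ≡ prodF n 5))
    × ((n % 4 ≡ 1 → lcmF n 6 * (2 * F (gcd (n * (n + 1)) 5) * F (gcd n 6)) ≡ prodF n 6)
       × (n % 4 ≡ 0 ⊎ n % 4 ≡ 2 ⊎ n % 4 ≡ 3 →
            lcmF n 6 * (6 * F (gcd (n * (n + 1)) 5) * F (gcd n 6)) ≡ prodF n 6))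
lemma2p4 n _ with denominators n
... | d₁ , d₂ , d₃ , (d₄ , d₄′) , (d₅ , d₅′) , (d₆ , d₆′) =
    trans (sym (*-identityʳ _)) (lcmF*d≡prodF n 1 d₁)
  , trans (sym (*-identityʳ _)) (lcmF*d≡prodF n 2 d₂)
  , lcmF*d≡prodF n 3 d₃
  , (lcmF*d≡prodF n 4 ∘ d₄ , lcmF*d≡prodF n 4 ∘ d₄′)
  , (lcmF*d≡prodF n 5 ∘ d₅ , lcmF*d≡prodF n 5 ∘ d₅′)
  , (lcmF*d≡prodF n 6 ∘ d₆ , lcmF*d≡prodF n 6 ∘ d₆′)
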